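{- Fix a positive integer $r$, let $N=(n-1)\cdot n\cdot r$, and suppose $d\geq n\cdot N+n\cdot(n-1)\cdot w_1\cdot|\underline{w}|$. Suppose that $\mathfrak{BP}(d,\underline{C};\underline{w})$ is $1$-feasible and $W^{min}>C_1$, and let $\mathcal{B}_\bullet$ be a $1$-feasible partition with $w(\mathcal{B}_1)=W^{min}$ and $n_1(\mathcal{B}_1)\geq N$. Then there exists a permutation $R_\bullet$ of $\{1,\dots,n\}$ with $R_1=1$ such that $n_i(\mathcal{B}_{R_i})\geq r$ for $i=2,\dots,n$.
   Context: Setting: integers $w_1\geq\cdots\geq w_n\geq0$, $|\underline{w}|=w_1+\cdots+w_n$, positive integer $d$, integers $C_1\geq\cdots\geq C_n$. $\mathcal{B}$ is the multiset with $d$ balls of weight $w_i$ for each $i$. A partition $\mathcal{B}_\bullet$ is $\mathcal{B}=\mathcal{B}_1\sqcup\cdots\sqcup\mathcal{B}_n$ with each $\mathcal{B}_i$ containing exactly $d$ balls; $w(\mathcal{B}_i)$ is its total weight and $n_i(\mathcal{B}_j)$ is the number of balls of weight $w_i$ in $\mathcal{B}_j$. The partition is $1$-feasible if $w(\mathcal{B}_i)\leq C_i$ for $i=2,\dots,n$; $\mathfrak{BP}(d,\underline{C};\underline{w})$ is $1$-feasible if such a partition exists. $W^{min}$ is the minimum of $w(\mathcal{B}_1)$ over all $1$-feasible partitions. -}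

module Defs where

open import Data.Nat using (ℕ; suc; _+_; _*_; _≤_)
open import Data.Integer using (ℤ; +_) renaming (_≤_ to _≤ℤ_)
open import Data.Fin using (Fin; zero; suc)
open import Data.List using (map; allFin)
open import Data.Nat.ListAction using (sum)
open import Data.Product using (Σ; _×_)
open import Relation.Binary.PropositionalEquality using (_≡_)

Σ[_] : ∀ {n} → (Fin n → ℕ) → ℕ
Σ[_] {n} f = sum (map f (allFin n))

-- A partition of the ball multiset, for n = suc m colours/boxes, recorded by
-- its count matrix:  count i j = n_i(B_j) = number of balls of weight w_i in B_j.
-- It is a partition of B (d balls of each weight w_i in total) into n boxes
-- with exactly d balls each.
record Partition (m d : ℕ) : Set where
  field
    count   : Fin (suc m) → Fin (suc m) → ℕ
    rowSum  : ∀ i → Σ[ (λ j → count i j) ] ≡ d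
    colSum  : ∀ j → Σ[ (λ i → count i j) ] ≡ d
open Partition public

weight : ∀ {m d} → (Fin (suc m) → ℕ) → Partition m d → Fin (suc m) → ℕ
weight w P j = Σ[ (λ i → count P i j * w i) ]

OneFeasible : ∀ {m d} → (Fin (suc m) → ℕ) → (Fin (suc m) → ℤ) → Partition m d → Set
OneFeasible w C P = ∀ (i : Fin _) → + weight w P (suc i) ≤ℤ C (suc i)

IsWmin : ∀ (m d : ℕ) → (Fin (suc m) → ℕ) → (Fin (suc m) → ℤ) → ℕ → Set
IsWmin m d w C W =
  Σ (Partition m d) (λ P → OneFeasible w C P × weight w P zero ≡ W)
  × (∀ (P : Partition m d) → OneFeasible w C P → W ≤ weight w P zero)

NonIncℕ : ∀ {n} → (Fin n → ℕ) → Set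
NonIncℕ {n} w = ∀ (i j : Fin n) → Data.Fin._≤_ i j → w j ≤ w i

NonIncℤ : ∀ {n} → (Fin n → ℤ) → Set
NonIncℤ {n} C = ∀ (i j : Fin n) → Data.Fin._≤_ i j → C j ≤ℤ C i

module Submission where

-- Write n = m + 1 and N = m(m+1)r. On the colours and boxes 2..n consider the bipartite
-- graph joining colour i to box j when n_i(B_j) ≥ r; a perfect matching of it, extended by
-- 1 ↦ 1, is the required permutation. Hall's condition holds by double counting: if a set S
-- of colours had at most |S| - 1 neighbouring boxes, its |S|·d balls would lie in box 1
-- (at most d - n_1(B_1) of them), in those neighbouring boxes (at most d each) or in the
-- remaining ones (fewer than r per colour and box, so at most m²r in all), which forces
-- n_1(B_1) ≤ m²r < N.

open import Data.Bool using (if_then_else_)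
open import Data.Fin using (Fin; zero; suc; punchOut)
open import Data.Fin.Permutation using (Permutation′; _⟨$⟩ʳ_; permutation; lift₀)
open import Data.Fin.Properties using (any?; punchOut-injective; injective⇒≤) renaming (_≟_ to _≟ᶠ_)
open import Data.Fin.Subset
open import Data.Fin.Subset.Properties
import Data.List as List using (tabulate)
open import Data.List.Properties using (map-tabulate)
open import Data.Nat using (ℕ; zero; suc; _+_; _*_; _≤_; _<_; z≤n; _≤?_)
open import Data.Nat.Induction using (<-wellFounded)
import Data.Nat.ListAction as List using (sum)
open import Data.Nat.Properties
open import Algebra.Properties.Semiring.Sum +-*-semiring
  using (sum; sum-cong-≗; ∑-distrib-+; ∑-comm; *-distribˡ-sum; *-distribʳ-sum)
open import Data.Product using (Σ; ∃; _×_; _,_; proj₁; proj₂)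
open import Data.Sum using (inj₁; inj₂)
open import Data.Vec using (_∷_; []; tabulate; here; there)
open import Data.Vec.Properties using (lookup∘tabulate; lookup⇒[]=; []=⇒lookup)
open import Function using (_∘_; id)
open import Function.Definitions using (Injective)
open import Induction.WellFounded using (Acc; acc)
open import Relation.Binary.PropositionalEquality
open import Relation.Nullary using (¬_; Dec; yes; no; does; contradiction)
open import Relation.Nullary.Decidable using (_×-dec_; dec-true)

open import Defs

private variable
  k : ℕ
  p q : Subset k
  x : Fin k

∣p∩q∣+∣p∪q∣≡∣p∣+∣q∣ : (p q : Subset k) → ∣ p ∩ q ∣ + ∣ p ∪ q ∣ ≡ ∣ p ∣ + ∣ q ∣
∣p∩q∣+∣p∪q∣≡∣p∣+∣q∣ []            []            = refl
∣p∩q∣+∣p∪q∣≡∣p∣+∣q∣ (inside  ∷ p) (inside  ∷ q) =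
  cong suc (trans (+-suc _ _) (trans (cong suc (∣p∩q∣+∣p∪q∣≡∣p∣+∣q∣ p q)) (sym (+-suc _ _))))
∣p∩q∣+∣p∪q∣≡∣p∣+∣q∣ (inside  ∷ p) (outside ∷ q) =
  trans (+-suc _ _) (cong suc (∣p∩q∣+∣p∪q∣≡∣p∣+∣q∣ p q))
∣p∩q∣+∣p∪q∣≡∣p∣+∣q∣ (outside ∷ p) (inside  ∷ q) =
  trans (+-suc _ _) (trans (cong suc (∣p∩q∣+∣p∪q∣≡∣p∣+∣q∣ p q)) (sym (+-suc _ _)))
∣p∩q∣+∣p∪q∣≡∣p∣+∣q∣ (outside ∷ p) (outside ∷ q) = ∣p∩q∣+∣p∪q∣≡∣p∣+∣q∣ p q

Empty⇒∣p∣≡0 : ∀ {k} {p : Subset k} → Empty p → ∣ p ∣ ≡ 0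
Empty⇒∣p∣≡0 {k} empty = trans (cong ∣_∣ (Empty-unique empty)) (∣⊥∣≡0 k)

∣p∣>0⇒Nonempty : 0 < ∣ p ∣ → Nonempty p
∣p∣>0⇒Nonempty {p = p} 0<∣p∣ with nonempty? p
... | yes nonempty = nonempty
... | no  empty    = contradiction (Empty⇒∣p∣≡0 empty) (>⇒≢ 0<∣p∣)

∣p∪q∣≤∣p∣+∣q∣ : (p q : Subset k) → ∣ p ∪ q ∣ ≤ ∣ p ∣ + ∣ q ∣
∣p∪q∣≤∣p∣+∣q∣ p q = ≤-trans (m≤n+m _ ∣ p ∩ q ∣) (≤-reflexive (∣p∩q∣+∣p∪q∣≡∣p∣+∣q∣ p q))

Empty[p∩q]⇒∣p∪q∣≡∣p∣+∣q∣ : Empty (p ∩ q) → ∣ p ∪ q ∣ ≡ ∣ p ∣ + ∣ q ∣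
Empty[p∩q]⇒∣p∪q∣≡∣p∣+∣q∣ {p = p} {q} disjoint =
  trans (cong (_+ ∣ p ∪ q ∣) (sym (Empty⇒∣p∣≡0 disjoint))) (∣p∩q∣+∣p∪q∣≡∣p∣+∣q∣ p q)

x∈p─q⇒x∉q : x ∈ p ─ q → x ∉ q
x∈p─q⇒x∉q {p = _ ∷ _} {inside  ∷ _} ()            here
x∈p─q⇒x∉q {p = _ ∷ _} {inside  ∷ _} (there x∈p─q) (there x∈q) = x∈p─q⇒x∉q x∈p─q x∈q
x∈p─q⇒x∉q {p = _ ∷ _} {outside ∷ _} (there x∈p─q) (there x∈q) = x∈p─q⇒x∉q x∈p─q x∈q

p∩q⊆p∩[q─r]∪r : (p q r : Subset k) → p ∩ q ⊆ (p ∩ (q ─ r)) ∪ r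
p∩q⊆p∩[q─r]∪r p q r {x} x∈p∩q with x ∈? r | x∈p∩q⁻ p q x∈p∩q
... | yes x∈r | _           = x∈p∪q⁺ (inj₂ x∈r)
... | no  x∉r | x∈p , x∈q = x∈p∪q⁺ (inj₁ (x∈p∩q⁺ (x∈p , x∈p∧x∉q⇒x∈p─q x∈q x∉r)))

∣p∩q∣≤∣p∩[q─r]∣+∣r∣ : (p q r : Subset k) → ∣ p ∩ q ∣ ≤ ∣ p ∩ (q ─ r) ∣ + ∣ r ∣
∣p∩q∣≤∣p∩[q─r]∣+∣r∣ p q r = ≤-trans (p⊆q⇒∣p∣≤∣q∣ (p∩q⊆p∩[q─r]∪r p q r)) (∣p∪q∣≤∣p∣+∣q∣ (p ∩ (q ─ r)) r)

x∈p⇒⁅x⁆⊆p : x ∈ p → ⁅ x ⁆ ⊆ p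
x∈p⇒⁅x⁆⊆p {x = x} x∈p y∈⁅x⁆ = subst (_∈ _) (sym (x∈⁅y⁆⇒x≡y x y∈⁅x⁆)) x∈p

injective⇒surjective : {f : Fin k → Fin k} → Injective _≡_ _≡_ f → ∀ y → ∃ λ x → f x ≡ y
injective⇒surjective {suc k} {f} f-injective y with any? (λ x → f x ≟ᶠ y)
... | yes found  = found
... | no  ∄found = contradiction (injective⇒≤ punchOut∘f-injective) 1+n≰n
  where
  y≢f : ∀ x → y ≢ f x
  y≢f x y≡fx = ∄found (x , sym y≡fx)
  punchOut∘f-injective : Injective _≡_ _≡_ (λ x → punchOut (y≢f x))
  punchOut∘f-injective eq = f-injective (punchOut-injective (y≢f _) (y≢f _) eq)

-- Halmos–Vaughan induction on ∣ A ∣: if some tight set S exists, match S inside its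
-- neighbourhood and A ─ S into what is left of B; otherwise any single edge can be used first.
module Hall {k : ℕ} {E : Fin k → Fin k → Set} (E? : ∀ i j → Dec (E i j)) where

  private variable
    A B S R : Subset k
    i j a c : Fin k

  neighbours : Subset k → Subset k
  neighbours S = tabulate λ j → does (any? λ i → i ∈? S ×-dec E? i j)

  ∈-neighbours⁺ : i ∈ S → E i j → j ∈ neighbours S
  ∈-neighbours⁺ {i} {S} {j} i∈S Eij =
    lookup⇒[]= j _ (trans (lookup∘tabulate _ j) (dec-true (any? _) (i , i∈S , Eij)))

  ∈-neighbours⁻ : j ∈ neighbours S → ∃ λ i → i ∈ S × E i j
  ∈-neighbours⁻ {j} {S} j∈N
    with any? (λ i → i ∈? S ×-dec E? i j) | trans (sym (lookup∘tabulate _ j)) ([]=⇒lookup j∈N)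
  ... | yes found | _  = found
  ... | no  _     | ()

  record Matching (A B : Subset k) : Set where
    field
      match           : Fin k → Fin k
      match-∈         : i ∈ A → match i ∈ B
      match-edge      : i ∈ A → E i (match i)
      match-injective : i ∈ A → j ∈ A → match i ≡ match j → i ≡ j

  HallCondition : Subset k → Subset k → Set
  HallCondition A B = ∀ {S} → S ⊆ A → ∣ S ∣ ≤ ∣ neighbours S ∩ B ∣

  empty-matching : Empty A → Matching A B
  empty-matching empty = record
    { match           = λ i → i
    ; match-∈         = λ i∈A → contradiction (_ , i∈A) empty
    ; match-edge      = λ i∈A → contradiction (_ , i∈A) empty
    ; match-injective = λ i∈A _ _ → contradiction (_ , i∈A) empty
    }

  singleton-matching : E a c → Matching ⁅ a ⁆ ⁅ c ⁆
  singleton-matching {a} {c} Eac = record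
    { match           = λ _ → c
    ; match-∈         = λ _ → x∈⁅x⁆ c
    ; match-edge      = λ i∈⁅a⁆ → subst (λ i → E i c) (sym (x∈⁅y⁆⇒x≡y a i∈⁅a⁆)) Eac
    ; match-injective = λ i∈⁅a⁆ j∈⁅a⁆ _ → trans (x∈⁅y⁆⇒x≡y a i∈⁅a⁆) (sym (x∈⁅y⁆⇒x≡y a j∈⁅a⁆))
    }

  matching-into-neighbours : Matching A B → Matching A (neighbours A ∩ B)
  matching-into-neighbours M = record
    { match           = match
    ; match-∈         = λ i∈A → x∈p∩q⁺ (∈-neighbours⁺ i∈A (match-edge i∈A) , match-∈ i∈A)
    ; match-edge      = match-edge
    ; match-injective = match-injective
    }
    where open Matching M

  extend-matching : S ⊆ A → R ⊆ B → Matching S R → Matching (A ─ S) (B ─ R) → Matching A B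
  extend-matching {S} {A} {R} {B} S⊆A R⊆B M₁ M₂ = record
    { match = match ; match-∈ = match-∈ ; match-edge = match-edge ; match-injective = match-injective }
    where
    module M₁ = Matching M₁
    module M₂ = Matching M₂
    match : Fin k → Fin k
    match i with i ∈? S
    ... | yes _ = M₁.match i
    ... | no  _ = M₂.match i
    match-∈ : i ∈ A → match i ∈ B
    match-∈ {i} i∈A with i ∈? S
    ... | yes i∈S = R⊆B (M₁.match-∈ i∈S)
    ... | no  i∉S = p─q⊆p B R (M₂.match-∈ (x∈p∧x∉q⇒x∈p─q i∈A i∉S))
    match-edge : i ∈ A → E i (match i)
    match-edge {i} i∈A with i ∈? S
    ... | yes i∈S = M₁.match-edge i∈S
    ... | no  i∉S = M₂.match-edge (x∈p∧x∉q⇒x∈p─q i∈A i∉S)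
    match-injective : i ∈ A → j ∈ A → match i ≡ match j → i ≡ j
    match-injective {i} {j} i∈A j∈A eq with i ∈? S | j ∈? S
    ... | yes i∈S | yes j∈S = M₁.match-injective i∈S j∈S eq
    ... | no  i∉S | no  j∉S = M₂.match-injective (x∈p∧x∉q⇒x∈p─q i∈A i∉S) (x∈p∧x∉q⇒x∈p─q j∈A j∉S) eq
    ... | yes i∈S | no  j∉S = contradiction (subst (_∈ R) eq (M₁.match-∈ i∈S))
                                (x∈p─q⇒x∉q (M₂.match-∈ (x∈p∧x∉q⇒x∈p─q j∈A j∉S)))
    ... | no  i∉S | yes j∈S = contradiction (subst (_∈ R) (sym eq) (M₁.match-∈ j∈S))
                                (x∈p─q⇒x∉q (M₂.match-∈ (x∈p∧x∉q⇒x∈p─q i∈A i∉S)))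

  hall-edge : HallCondition A B → a ∈ A → ∃ λ c → c ∈ B × E a c
  hall-edge {A} {B} {a} hall-A a∈A =
    let c , c∈N∩B       = ∣p∣>0⇒Nonempty (subst (_≤ ∣ neighbours ⁅ a ⁆ ∩ B ∣) (∣⁅x⁆∣≡1 a)
                                                (hall-A (x∈p⇒⁅x⁆⊆p a∈A)))
        c∈N , c∈B       = x∈p∩q⁻ _ B c∈N∩B
        i , i∈⁅a⁆ , Eic = ∈-neighbours⁻ c∈N
    in c , c∈B , subst (λ i → E i c) (x∈⁅y⁆⇒x≡y a i∈⁅a⁆) Eic

  Tight : Subset k → Subset k → Subset k → Set
  Tight A B S = Nonempty S × S ⊂ A × ∣ neighbours S ∩ B ∣ ≤ ∣ S ∣

  tight? : ∀ A B S → Dec (Tight A B S)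
  tight? A B S = nonempty? S ×-dec S ⊂? A ×-dec ∣ neighbours S ∩ B ∣ ≤? ∣ S ∣

  MatchingsBelow : ℕ → Set
  MatchingsBelow n = ∀ {A B} → ∣ A ∣ < n → HallCondition A B → Matching A B

  match-through-tight-set : MatchingsBelow ∣ A ∣ → HallCondition A B → Tight A B S → Matching A B
  match-through-tight-set {A} {B} {S} hall< hall-A ((y , y∈S) , S⊂A , tight) =
    extend-matching S⊆A (p∩q⊆q (neighbours S) B) (matching-into-neighbours M₁) M₂
    where
    open ≤-Reasoning
    S⊆A : S ⊆ A
    S⊆A = p⊂q⇒p⊆q S⊂A
    R′ : Subset k
    R′ = neighbours S ∩ B
    M₁ : Matching S B
    M₁ = hall< (p⊂q⇒∣p∣<∣q∣ S⊂A) (λ T⊆S → hall-A (⊆-trans T⊆S S⊆A))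
    hall-rest : HallCondition (A ─ S) (B ─ R′)
    hall-rest {T} T⊆A─S = +-cancelʳ-≤ ∣ S ∣ ∣ T ∣ _ (begin
      ∣ T ∣ + ∣ S ∣                                 ≡⟨ Empty[p∩q]⇒∣p∪q∣≡∣p∣+∣q∣ disjoint ⟨
      ∣ T ∪ S ∣                                     ≤⟨ hall-A T∪S⊆A ⟩
      ∣ neighbours (T ∪ S) ∩ B ∣                    ≤⟨ ∣p∩q∣≤∣p∩[q─r]∣+∣r∣ (neighbours (T ∪ S)) B R′ ⟩
      ∣ neighbours (T ∪ S) ∩ (B ─ R′) ∣ + ∣ R′ ∣      ≤⟨ +-mono-≤ (p⊆q⇒∣p∣≤∣q∣ unmatched-neighbours) tight ⟩
      ∣ neighbours T ∩ (B ─ R′) ∣ + ∣ S ∣            ∎)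
      where
      disjoint : Empty (T ∩ S)
      disjoint (x , x∈T∩S) = let x∈T , x∈S = x∈p∩q⁻ T S x∈T∩S in x∈p─q⇒x∉q (T⊆A─S x∈T) x∈S
      T∪S⊆A : T ∪ S ⊆ A
      T∪S⊆A x∈T∪S with x∈p∪q⁻ T S x∈T∪S
      ... | inj₁ x∈T = p─q⊆p A S (T⊆A─S x∈T)
      ... | inj₂ x∈S = S⊆A x∈S
      unmatched-neighbours : neighbours (T ∪ S) ∩ (B ─ R′) ⊆ neighbours T ∩ (B ─ R′)
      unmatched-neighbours j∈ with x∈p∩q⁻ _ (B ─ R′) j∈
      ... | j∈N , j∈B─R′ with ∈-neighbours⁻ j∈N
      ... | i , i∈T∪S , Eij with x∈p∪q⁻ T S i∈T∪S
      ... | inj₁ i∈T = x∈p∩q⁺ (∈-neighbours⁺ i∈T Eij , j∈B─R′)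
      ... | inj₂ i∈S = contradiction (x∈p∩q⁺ (∈-neighbours⁺ i∈S Eij , p─q⊆p B R′ j∈B─R′))
                                     (x∈p─q⇒x∉q j∈B─R′)
    M₂ : Matching (A ─ S) (B ─ R′)
    M₂ = hall< (p∩q≢∅⇒∣p─q∣<∣p∣ A S (y , x∈p∩q⁺ (S⊆A y∈S , y∈S))) hall-rest

  match-through-an-edge : MatchingsBelow ∣ A ∣ → HallCondition A B → (∀ S → ¬ Tight A B S) →
                          Matching A B
  match-through-an-edge {A} {B} hall< hall-A no-tight with nonempty? A
  ... | no  empty       = empty-matching empty
  ... | yes (a , a∈A) with hall-edge hall-A a∈A
  ... | c , c∈B , Eac =
    extend-matching (x∈p⇒⁅x⁆⊆p a∈A) (x∈p⇒⁅x⁆⊆p c∈B) (singleton-matching Eac)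
                    (hall< (x∈p⇒∣p-x∣<∣p∣ a∈A) hall-rest)
    where
    open ≤-Reasoning
    hall-rest : HallCondition (A - a) (B - c)
    hall-rest {T} T⊆A-a with nonempty? T
    ... | no  empty    = subst (_≤ ∣ neighbours T ∩ (B - c) ∣) (sym (Empty⇒∣p∣≡0 empty)) z≤n
    ... | yes nonempty = ≤-pred (begin
      suc ∣ T ∣                          ≤⟨ ≰⇒> (λ tight → no-tight T (nonempty , T⊂A , tight)) ⟩
      ∣ neighbours T ∩ B ∣               ≤⟨ ∣p∩q∣≤∣p∩[q─r]∣+∣r∣ (neighbours T) B ⁅ c ⁆ ⟩
      n + ∣ ⁅ c ⁆ ∣                      ≡⟨ cong (n +_) (∣⁅x⁆∣≡1 c) ⟩
      n + 1                              ≡⟨ +-comm n 1 ⟩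
      suc n                              ∎)
      where
      n : ℕ
      n = ∣ neighbours T ∩ (B - c) ∣
      T⊂A : T ⊂ A
      T⊂A = ⊆-trans T⊆A-a (p─q⊆p A ⁅ a ⁆) , a , a∈A , λ a∈T → x∈p─q⇒x∉q (T⊆A-a a∈T) (x∈⁅x⁆ a)

  hall-acc : Acc _<_ ∣ A ∣ → HallCondition A B → Matching A B
  hall-acc {A} {B} (acc rs) hall-A with anySubset? (tight? A B)
  ... | yes (S , tight) = match-through-tight-set (λ lt → hall-acc (rs lt)) hall-A tight
  ... | no  ∄tight      = match-through-an-edge (λ lt → hall-acc (rs lt)) hall-A (λ S tight → ∄tight (S , tight))

  hall : HallCondition A B → Matching A B
  hall = hall-acc (<-wellFounded _)

injective⇒permutation : {f : Fin k → Fin k} → Injective _≡_ _≡_ f →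
                        Σ (Permutation′ k) λ π → ∀ i → π ⟨$⟩ʳ i ≡ f i
injective⇒permutation {f = f} f-injective =
  permutation f (proj₁ ∘ preimage) (proj₂ ∘ preimage) (λ x → f-injective (proj₂ (preimage (f x)))) ,
  λ _ → refl
  where
  preimage : ∀ y → ∃ λ x → f x ≡ y
  preimage = injective⇒surjective f-injective

Σ[]≡sum : (f : Fin k → ℕ) → Σ[ f ] ≡ sum f
Σ[]≡sum f = trans (cong List.sum (map-tabulate id f)) (sum-tabulate f)
  where
  sum-tabulate : ∀ {n} (g : Fin n → ℕ) → List.sum (List.tabulate g) ≡ sum g
  sum-tabulate {zero}  g = refl
  sum-tabulate {suc n} g = cong (g zero +_) (sum-tabulate (g ∘ suc))

sum-mono-≤ : (f g : Fin k → ℕ) → (∀ i → f i ≤ g i) → sum f ≤ sum g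
sum-mono-≤ {zero}  _ _ _   = z≤n
sum-mono-≤ {suc k} f g f≤g = +-mono-≤ (f≤g zero) (sum-mono-≤ (f ∘ suc) (g ∘ suc) (f≤g ∘ suc))

sum-const : ∀ k n → sum {k} (λ _ → n) ≡ k * n
sum-const zero    n = refl
sum-const (suc k) n = cong (n +_) (sum-const k n)

𝟙 : Subset k → Fin k → ℕ
𝟙 p i = if does (i ∈? p) then 1 else 0

sum-𝟙 : (p : Subset k) → sum (𝟙 p) ≡ ∣ p ∣
sum-𝟙 []            = refl
sum-𝟙 (inside  ∷ p) = cong suc (sum-𝟙 p)
sum-𝟙 (outside ∷ p) = sum-𝟙 p

𝟙*-≤ : (p : Subset k) (x : Fin k) {n m : ℕ} → (x ∈ p → n ≤ m) → 𝟙 p x * n ≤ m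
𝟙*-≤ p x {n} n≤m with x ∈? p
... | yes x∈p = subst (_≤ _) (sym (+-identityʳ n)) (n≤m x∈p)
... | no  _   = z≤n

module LargeEntryGraph {m d : ℕ} (B : Partition m d) (r : ℕ) where

  open Hall (λ i j → r ≤? count B (suc i) (suc j)) public
  open ≤-Reasoning

  c : Fin (suc m) → Fin (suc m) → ℕ
  c = count B

  column-sum : ∀ j → sum (λ i → c i j) ≡ d
  column-sum j = trans (sym (Σ[]≡sum (λ i → c i j))) (colSum B j)

  columnOf : Subset m → Fin (suc m) → Fin m → ℕ
  columnOf S j i = 𝟙 S i * c (suc i) j

  first-column-mass : Subset m → ℕ
  first-column-mass S = sum (columnOf S zero)

  lower-block-mass : Subset m → ℕ
  lower-block-mass S = sum (λ j → sum (columnOf S (suc j)))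

  rows-split : ∀ S → ∣ S ∣ * d ≡ first-column-mass S + lower-block-mass S
  rows-split S = begin-equality
    ∣ S ∣ * d                     ≡⟨ cong (_* d) (sum-𝟙 S) ⟨
    sum (𝟙 S) * d                 ≡⟨ *-distribʳ-sum d (𝟙 S) ⟩
    sum (λ i → 𝟙 S i * d)         ≡⟨ sum-cong-≗ split-row ⟩
    sum (λ i → columnOf S zero i + sum (λ j → columnOf S (suc j) i))
                                  ≡⟨ ∑-distrib-+ (columnOf S zero) _ ⟩
    first-column-mass S + sum (λ i → sum (λ j → columnOf S (suc j) i))
                                  ≡⟨ cong (first-column-mass S +_) (∑-comm (λ i j → columnOf S (suc j) i)) ⟩
    first-column-mass S + lower-block-mass S ∎
    where
    split-row : ∀ i → 𝟙 S i * d ≡ columnOf S zero i + sum (λ j → columnOf S (suc j) i)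
    split-row i = begin-equality
      𝟙 S i * d
        ≡⟨ cong (𝟙 S i *_) (trans (sym (Σ[]≡sum (c (suc i)))) (rowSum B (suc i))) ⟨
      𝟙 S i * (c (suc i) zero + sum (λ j → c (suc i) (suc j)))
        ≡⟨ *-distribˡ-+ (𝟙 S i) (c (suc i) zero) _ ⟩
      columnOf S zero i + 𝟙 S i * sum (λ j → c (suc i) (suc j))
        ≡⟨ cong (columnOf S zero i +_) (*-distribˡ-sum (𝟙 S i) (λ j → c (suc i) (suc j))) ⟩
      columnOf S zero i + sum (λ j → columnOf S (suc j) i)
        ∎

  sum-columnOf≤ : ∀ S j → sum (columnOf S j) ≤ sum (λ i → c (suc i) j)
  sum-columnOf≤ S j = sum-mono-≤ (columnOf S j) (λ i → c (suc i) j) (λ i → 𝟙*-≤ S i λ _ → ≤-refl)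

  first-column-bound : ∀ S → c zero zero + first-column-mass S ≤ d
  first-column-bound S = begin
    c zero zero + first-column-mass S          ≤⟨ +-monoʳ-≤ (c zero zero) (sum-columnOf≤ S zero) ⟩
    c zero zero + sum (λ i → c (suc i) zero)   ≡⟨ column-sum zero ⟩
    d                                          ∎

  column-bound : ∀ S j → sum (columnOf S (suc j)) ≤ 𝟙 (neighbours S) j * d + m * r
  -- The with-abstraction evaluates 𝟙 (neighbours S) j on the right to 1 or 0.
  column-bound S j with j ∈? neighbours S
  ... | yes _   = begin
    sum (columnOf S (suc j))        ≤⟨ sum-columnOf≤ S (suc j) ⟩
    sum (λ i → c (suc i) (suc j))   ≤⟨ m≤n+m _ (c zero (suc j)) ⟩
    sum (λ i → c i (suc j))         ≡⟨ column-sum (suc j) ⟩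
    d                               ≡⟨ *-identityˡ d ⟨
    1 * d                           ≤⟨ m≤m+n (1 * d) (m * r) ⟩
    1 * d + m * r                   ∎
  ... | no  j∉N = begin
    sum (columnOf S (suc j))        ≤⟨ sum-mono-≤ (columnOf S (suc j)) (λ _ → r) small-entry ⟩
    sum (λ (_ : Fin m) → r)         ≡⟨ sum-const m r ⟩
    m * r                           ∎
    where
    small-entry : ∀ i → columnOf S (suc j) i ≤ r
    small-entry i = 𝟙*-≤ S i λ i∈S → <⇒≤ (≰⇒> λ r≤c → j∉N (∈-neighbours⁺ i∈S r≤c))

  lower-block-bound : ∀ S → lower-block-mass S ≤ ∣ neighbours S ∣ * d + m * (m * r)
  lower-block-bound S = begin
    lower-block-mass S                                   ≤⟨ sum-mono-≤ _ (λ j → 𝟙 N j * d + m * r) (column-bound S) ⟩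
    sum (λ j → 𝟙 N j * d + m * r)                        ≡⟨ ∑-distrib-+ (λ j → 𝟙 N j * d) (λ _ → m * r) ⟩
    sum (λ j → 𝟙 N j * d) + sum (λ (_ : Fin m) → m * r) ≡⟨ cong₂ _+_ (sym (*-distribʳ-sum d (𝟙 N))) (sum-const m (m * r)) ⟩
    sum (𝟙 N) * d + m * (m * r)                          ≡⟨ cong (λ n → n * d + m * (m * r)) (sum-𝟙 N) ⟩
    ∣ N ∣ * d + m * (m * r)                              ∎
    where
    N : Subset m
    N = neighbours S

  hall-deficiency : ∀ S → c zero zero + ∣ S ∣ * d ≤ suc ∣ neighbours S ∣ * d + m * (m * r)
  hall-deficiency S = begin
    c zero zero + ∣ S ∣ * d                                  ≡⟨ cong (c zero zero +_) (rows-split S) ⟩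
    c zero zero + (first-column-mass S + lower-block-mass S) ≡⟨ +-assoc (c zero zero) _ _ ⟨
    c zero zero + first-column-mass S + lower-block-mass S   ≤⟨ +-mono-≤ (first-column-bound S) (lower-block-bound S) ⟩
    d + (∣ neighbours S ∣ * d + m * (m * r))                 ≡⟨ +-assoc d _ _ ⟨
    suc ∣ neighbours S ∣ * d + m * (m * r)                   ∎

  hall-condition : 1 ≤ r → m * suc m * r ≤ c zero zero → HallCondition ⊤ ⊤
  hall-condition 1≤r N≤c₀₀ {S} _ =
    subst (∣ S ∣ ≤_) (cong ∣_∣ (sym (∩-identityʳ (neighbours S)))) (≮⇒≥ λ deficient → n≮0 (begin-strict
      ∣ neighbours S ∣   <⟨ deficient ⟩
      ∣ S ∣              ≤⟨ ∣p∣≤n S ⟩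
      m                  ≡⟨ *-identityʳ m ⟨
      m * 1              ≤⟨ *-monoʳ-≤ m 1≤r ⟩
      m * r              ≤⟨ m*r≤0 deficient ⟩
      0                  ∎))
    where
    c₀₀≤m*[m*r] : ∣ neighbours S ∣ < ∣ S ∣ → c zero zero ≤ m * (m * r)
    c₀₀≤m*[m*r] deficient = +-cancelˡ-≤ (suc ∣ neighbours S ∣ * d) (c zero zero) (m * (m * r)) (begin
      suc ∣ neighbours S ∣ * d + c zero zero  ≡⟨ +-comm _ (c zero zero) ⟩
      c zero zero + suc ∣ neighbours S ∣ * d  ≤⟨ +-monoʳ-≤ (c zero zero) (*-monoˡ-≤ d deficient) ⟩
      c zero zero + ∣ S ∣ * d                 ≤⟨ hall-deficiency S ⟩
      suc ∣ neighbours S ∣ * d + m * (m * r)  ∎)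
    m*r≤0 : ∣ neighbours S ∣ < ∣ S ∣ → m * r ≤ 0
    m*r≤0 deficient = +-cancelʳ-≤ (m * (m * r)) (m * r) 0 (begin
      m * r + m * (m * r)  ≡⟨ cong (m * r +_) (*-assoc m m r) ⟨
      m * r + m * m * r    ≡⟨ *-distribʳ-+ r m (m * m) ⟨
      (m + m * m) * r      ≡⟨ cong (_* r) (*-suc m m) ⟨
      m * suc m * r        ≤⟨ N≤c₀₀ ⟩
      c zero zero          ≤⟨ c₀₀≤m*[m*r] deficient ⟩
      m * (m * r)          ∎)

-- Imported only here: its prefix +_ would make the sections (n +_) above ambiguous.
open import Data.Integer using (ℤ; +_) renaming (_<_ to _<ℤ_)

theorem4p1 : (m : ℕ) (w : Fin (suc m) → ℕ) (C : Fin (suc m) → ℤ) (d r : ℕ) →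
    NonIncℕ w → NonIncℤ C → 1 ≤ d → 1 ≤ r →
    suc m * (m * suc m * r) + suc m * m * w zero * Σ[ w ] ≤ d →
    (W : ℕ) → IsWmin m d w C W → C zero <ℤ + W →
    (B : Partition m d) → OneFeasible w C B → weight w B zero ≡ W →
    m * suc m * r ≤ count B zero zero →
    Σ (Permutation′ (suc m)) (λ R →
      (R ⟨$⟩ʳ zero ≡ zero) × (∀ (i : Fin m) → r ≤ count B (suc i) (R ⟨$⟩ʳ suc i)))
theorem4p1 m w C d r _ _ _ 1≤r _ W _ _ B _ _ N≤c₀₀ = lift₀ π , refl , r≤entry
  where
  open LargeEntryGraph B r using (module Matching; hall; hall-condition)
  open Matching (hall (hall-condition 1≤r N≤c₀₀))
  matching-permutation : Σ (Permutation′ m) λ π → ∀ i → π ⟨$⟩ʳ i ≡ match i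
  matching-permutation = injective⇒permutation (match-injective ∈⊤ ∈⊤)
  π : Permutation′ m
  π = proj₁ matching-permutation
  r≤entry : ∀ i → r ≤ count B (suc i) (lift₀ π ⟨$⟩ʳ suc i)
  r≤entry i = subst (λ j → r ≤ count B (suc i) (suc j)) (sym (proj₂ matching-permutation i)) (match-edge ∈⊤)
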